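{- Let $k\geq 4$ be an integer. There exists a connected graph $G$ with $\gamma_t^{\mathrm{ID}}(G)=k$ and $\gamma_E^{\mathrm{ID}}(G)=2^k-1$.
   Context: All graphs are finite, simple and undirected. $N[v]$ is the closed neighbourhood of $v$; for $C\subseteq V(G)$, $I(v)=N[v]\cap C$. A total dominating identifying code is a set $C$ with $I(u)\neq I(v)$ for all distinct vertices $u,v$ and such that every vertex has a neighbour in $C$; $\gamma_t^{\mathrm{ID}}(G)$ is its minimum size. An error-correcting identifying code is a set $C\subseteq V(G)$ such that $|I(u)|\geq 3$ for every vertex $u$ and $|I(u)\triangle I(v)|\geq 3$ for all distinct vertices $u,v$ ($\triangle$ denotes symmetric difference); $\gamma_E^{\mathrm{ID}}(G)$ is its minimum size. -}

module Defs where

open import Data.Nat using (ℕ; _≤_)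
open import Data.Bool using (Bool; true; false; _∨_; _∧_; _xor_)
open import Data.Fin using (Fin; _≟_)
open import Data.Fin.Subset using (Subset; _∈_; _∩_; ∣_∣)
open import Data.Vec using (tabulate; zipWith)
open import Data.Product using (Σ; _×_; ∃)
open import Relation.Nullary using (¬_)
open import Relation.Nullary.Decidable using (⌊_⌋)
open import Relation.Binary.PropositionalEquality using (_≡_)
open import Relation.Binary.Construct.Closure.ReflexiveTransitive using (Star)

record Graph : Set where
  field
    n      : ℕ
    adj    : Fin n → Fin n → Bool
    sym    : ∀ u v → adj u v ≡ adj v u
    irrefl : ∀ v → adj v v ≡ false
open Graph public

Adj : (G : Graph) → Fin (n G) → Fin (n G) → Set
Adj G u v = adj G u v ≡ true

Connected : Graph → Set
Connected G = ∀ u v → Star (Adj G) u v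

N[_] : {G : Graph} → Fin (n G) → Subset (n G)
N[_] {G} v = tabulate (λ u → ⌊ u ≟ v ⌋ ∨ adj G v u)

I : (G : Graph) → Subset (n G) → Fin (n G) → Subset (n G)
I G C v = N[_] {G} v ∩ C

_△_ : ∀ {m} → Subset m → Subset m → Subset m
A △ B = zipWith _xor_ A B

IsTDIdCode : (G : Graph) → Subset (n G) → Set
IsTDIdCode G C =
  (∀ u v → ¬ (u ≡ v) → ¬ (I G C u ≡ I G C v)) ×
  (∀ v → ∃ λ u → Adj G v u × u ∈ C)

IsECIdCode : (G : Graph) → Subset (n G) → Set
IsECIdCode G C =
  (∀ u → 3 ≤ ∣ I G C u ∣) ×
  (∀ u v → ¬ (u ≡ v) → 3 ≤ ∣ I G C u △ I G C v ∣)

IsMinSize : (G : Graph) → (Subset (n G) → Set) → ℕ → Set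
IsMinSize G P m =
  (Σ (Subset (n G)) λ C → P C × ∣ C ∣ ≡ m) ×
  (∀ C → P C → m ≤ ∣ C ∣)

γtID≡ : Graph → ℕ → Set
γtID≡ G m = IsMinSize G (IsTDIdCode G) m

γEID≡ : Graph → ℕ → Set
γEID≡ G m = IsMinSize G (IsECIdCode G) m

-- Take as vertices the nonzero bit vectors X of length k. Let c 0 be the all-ones vector and
-- c j = {0, j} for j > 0; join X to c j whenever bit j of X is set, and join each unit vector
-- e j to its complement ē j. The trace of X on C₀ = {c j} is then X itself, so C₀ is a total
-- dominating identifying code of size k; conversely any such code C separates the 2 ^ k − 1
-- vertices by distinct nonempty subsets of C, whence 2 ^ k ≤ 2 ^ ∣ C ∣.
-- A case analysis on whether a vertex is some c j, e j, ē j, or none of these shows that every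
-- closed neighbourhood, and every symmetric difference of two, has three elements, so the whole
-- vertex set is an error-correcting code. Conversely every vertex x is forced into every such code:
-- some closed neighbourhood, or some symmetric difference of two, consists of x and at most two
-- further vertices.

module Submission where

open import Defs hiding (sym)
open import Data.Nat using (ℕ; zero; suc; _+_; _∸_; _^_; _≤_; _<_; z≤n; s≤s)
open import Data.Nat.Properties
  using (≤-trans; ≤-reflexive; ≤-antisym; ≮⇒≥; <⇒≱; ^-monoʳ-<; n≤1+n; +-suc; +-monoʳ-≤; m^n>0; m+[n∸m]≡n)
open import Data.Bool using (Bool; true; false; not; _∧_; _∨_; _xor_)
open import Data.Bool.Properties using (∨-zeroʳ) renaming (_≟_ to _≟ᴮ_)
open import Data.Fin as Fin using (Fin; zero; suc; toℕ; cast; splitAt; _↑ˡ_; _↑ʳ_)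
open import Data.Fin.Properties
  using (any?; injective⇒≤; suc-injective; toℕ-injective; toℕ-cast; cast-involutive;
         splitAt-↑ˡ; splitAt-↑ʳ; join-splitAt; toℕ-↑ˡ)
  renaming (_≟_ to _≟ᶠ_)
open import Data.Fin.Subset using (Subset; ⁅_⁆; ⊥; ⊤; _∪_; _∈_; _∉_; _⊆_; ∣_∣)
open import Data.Fin.Subset.Properties
  using (_∈?_; x∈p∧x≢y⇒x∈p-y; x∈p⇒∣p-x∣<∣p∣; p⊆q⇒∣p∣≤∣q∣; x∈p∪q⁺; x∈⁅x⁆; ∣⁅x⁆∣≡1;
         ∣⊥∣≡0; ∣⊤∣≡n; drop-∷-⊆; ⊥⊆; ∉⊥; ∈⊤; p∩q⊆q; x∈p∩q⁺; x∈p∩q⁻)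
open import Data.Vec using (Vec; []; _∷_; here; lookup; tabulate; replicate)
open import Data.Vec.Properties
  using (≡-dec; ∷-injective; lookup∘tabulate; tabulate∘lookup; tabulate-cong; lookup-replicate;
         lookup-zipWith; []=⇒lookup; lookup⇒[]=)
open import Data.Product using (Σ; ∃; _×_; _,_; proj₁; proj₂)
open import Data.Sum using (_⊎_; inj₁; inj₂)
open import Data.Empty using (⊥-elim)
open import Function using (_∘_)
open import Relation.Nullary using (¬_; Dec; yes; no)
open import Relation.Nullary.Decidable using (⌊_⌋; does; dec-true; dec-false; does-⇔; map′; ¬?; _×-dec_; _⊎-dec_)
open import Relation.Binary.PropositionalEquality
open import Relation.Binary.Construct.Closure.ReflexiveTransitive using (Star; ε; _◅_; _◅◅_; reverse)
open import Function.Bundles using (mk⇔)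

-- Finite subsets

∣p∪q∣≤∣p∣+∣q∣ : ∀ {n} (p q : Subset n) → ∣ p ∪ q ∣ ≤ ∣ p ∣ + ∣ q ∣
∣p∪q∣≤∣p∣+∣q∣ []          []          = z≤n
∣p∪q∣≤∣p∣+∣q∣ (true ∷ p)  (true ∷ q)  =
  s≤s (≤-trans (∣p∪q∣≤∣p∣+∣q∣ p q) (+-monoʳ-≤ ∣ p ∣ (n≤1+n ∣ q ∣)))
∣p∪q∣≤∣p∣+∣q∣ (true ∷ p)  (false ∷ q) = s≤s (∣p∪q∣≤∣p∣+∣q∣ p q)
∣p∪q∣≤∣p∣+∣q∣ (false ∷ p) (true ∷ q)  rewrite +-suc ∣ p ∣ ∣ q ∣ = s≤s (∣p∪q∣≤∣p∣+∣q∣ p q)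
∣p∪q∣≤∣p∣+∣q∣ (false ∷ p) (false ∷ q) = ∣p∪q∣≤∣p∣+∣q∣ p q

3≤∣p∣ : ∀ {n} {p : Subset n} {a b c : Fin n} → a ≢ b → a ≢ c → b ≢ c →
        a ∈ p → b ∈ p → c ∈ p → 3 ≤ ∣ p ∣
3≤∣p∣ a≢b a≢c b≢c a∈p b∈p c∈p =
  ≤-trans (s≤s (≤-trans (s≤s (≤-trans (s≤s z≤n) (x∈p⇒∣p-x∣<∣p∣ c∈p-a-b)))
                        (x∈p⇒∣p-x∣<∣p∣ b∈p-a)))
          (x∈p⇒∣p-x∣<∣p∣ a∈p)
  where
  b∈p-a   = x∈p∧x≢y⇒x∈p-y b∈p (a≢b ∘ sym)
  c∈p-a-b = x∈p∧x≢y⇒x∈p-y (x∈p∧x≢y⇒x∈p-y c∈p (a≢c ∘ sym)) (b≢c ∘ sym)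

OneOf₃ : {A : Set} → A → A → A → A → Set
OneOf₃ x a b w = w ≡ x ⊎ w ≡ a ⊎ w ≡ b

OneOf₃-swap₁₂ : ∀ {A : Set} {x a b w : A} → OneOf₃ x a b w → OneOf₃ a x b w
OneOf₃-swap₁₂ (inj₁ w≡x)        = inj₂ (inj₁ w≡x)
OneOf₃-swap₁₂ (inj₂ (inj₁ w≡a)) = inj₁ w≡a
OneOf₃-swap₁₂ (inj₂ (inj₂ w≡b)) = inj₂ (inj₂ w≡b)

OneOf₃-swap₁₃ : ∀ {A : Set} {x a b w : A} → OneOf₃ x a b w → OneOf₃ b a x w
OneOf₃-swap₁₃ (inj₁ w≡x)        = inj₂ (inj₂ w≡x)
OneOf₃-swap₁₃ (inj₂ (inj₁ w≡a)) = inj₂ (inj₁ w≡a)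
OneOf₃-swap₁₃ (inj₂ (inj₂ w≡b)) = inj₁ w≡b

∣p∣≤2 : ∀ {n} {p : Subset n} (a b : Fin n) → (∀ w → w ∈ p → w ≡ a ⊎ w ≡ b) → ∣ p ∣ ≤ 2
∣p∣≤2 {p = p} a b p⊆ab = ≤-trans (p⊆q⇒∣p∣≤∣q∣ p⊆⁅a⁆∪⁅b⁆) ∣⁅a⁆∪⁅b⁆∣≤2
  where
  p⊆⁅a⁆∪⁅b⁆ : p ⊆ ⁅ a ⁆ ∪ ⁅ b ⁆
  p⊆⁅a⁆∪⁅b⁆ {w} w∈p with p⊆ab w w∈p
  ... | inj₁ refl = x∈p∪q⁺ (inj₁ (x∈⁅x⁆ w))
  ... | inj₂ refl = x∈p∪q⁺ (inj₂ (x∈⁅x⁆ w))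
  ∣⁅a⁆∪⁅b⁆∣≤2 : ∣ ⁅ a ⁆ ∪ ⁅ b ⁆ ∣ ≤ 2
  ∣⁅a⁆∪⁅b⁆∣≤2 = ≤-trans (∣p∪q∣≤∣p∣+∣q∣ ⁅ a ⁆ ⁅ b ⁆)
                        (≤-reflexive (cong₂ _+_ (∣⁅x⁆∣≡1 a) (∣⁅x⁆∣≡1 b)))

3≤∣p∣⇒forced : ∀ {n} {p : Subset n} (x a b : Fin n) →
               (∀ w → w ∈ p → OneOf₃ x a b w) → 3 ≤ ∣ p ∣ → x ∈ p
3≤∣p∣⇒forced {p = p} x a b p⊆xab 3≤∣p∣ with x ∈? p
... | yes x∈p = x∈p
... | no  x∉p = ⊥-elim (3≰2 (≤-trans 3≤∣p∣ (∣p∣≤2 a b p⊆ab)))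
  where
  3≰2 : ¬ 3 ≤ 2
  3≰2 (s≤s (s≤s ()))
  p⊆ab : ∀ w → w ∈ p → w ≡ a ⊎ w ≡ b
  p⊆ab w w∈p with p⊆xab w w∈p
  ... | inj₁ refl = ⊥-elim (x∉p w∈p)
  ... | inj₂ w≡a⊎b = w≡a⊎b

∈⇒lookup : ∀ {n} {p : Subset n} {x} → x ∈ p → lookup p x ≡ true
∈⇒lookup = []=⇒lookup

lookup⇒∈ : ∀ {n} {p : Subset n} {x} → lookup p x ≡ true → x ∈ p
lookup⇒∈ {p = p} {x} = lookup⇒[]= x p

∉⇒lookup≡false : ∀ {n} {p : Subset n} {x} → x ∉ p → lookup p x ≡ false
∉⇒lookup≡false {p = p} {x} x∉p with lookup p x in px
... | true  = ⊥-elim (x∉p (lookup⇒∈ px))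
... | false = refl

lookup≡false⇒∉ : ∀ {n} {p : Subset n} {x} → lookup p x ≡ false → x ∉ p
lookup≡false⇒∉ px x∈p with trans (sym (∈⇒lookup x∈p)) px
... | ()

x∈p△q⁻ : ∀ {n} (p q : Subset n) {x} → x ∈ p △ q → (x ∈ p × x ∉ q) ⊎ (x ∉ p × x ∈ q)
x∈p△q⁻ p q {x} x∈p△q
  with lookup p x in px | lookup q x in qx
     | trans (sym (lookup-zipWith _xor_ x p q)) (∈⇒lookup x∈p△q)
... | true  | false | _ = inj₁ (lookup⇒∈ px , lookup≡false⇒∉ qx)
... | false | true  | _ = inj₂ (lookup≡false⇒∉ px , lookup⇒∈ qx)
... | true  | true  | ()
... | false | false | ()

x∈p△q⁺ : ∀ {n} (p q : Subset n) {x} → (x ∈ p × x ∉ q) ⊎ (x ∉ p × x ∈ q) → x ∈ p △ q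
x∈p△q⁺ p q {x} (inj₁ (x∈p , x∉q)) = lookup⇒∈ (trans (lookup-zipWith _xor_ x p q)
  (cong₂ _xor_ (∈⇒lookup x∈p) (∉⇒lookup≡false x∉q)))
x∈p△q⁺ p q {x} (inj₂ (x∉p , x∈q)) = lookup⇒∈ (trans (lookup-zipWith _xor_ x p q)
  (cong₂ _xor_ (∉⇒lookup≡false x∉p) (∈⇒lookup x∈q)))

image : ∀ {n r} → (Fin r → Fin n) → Subset n
image {r = zero}  f = ⊥
image {r = suc r} f = ⁅ f zero ⁆ ∪ image (f ∘ suc)

∣image∣≤ : ∀ {n r} (f : Fin r → Fin n) → ∣ image f ∣ ≤ r
∣image∣≤ {n} {zero}  f = ≤-reflexive (∣⊥∣≡0 n)
∣image∣≤ {r = suc r} f = ≤-trans (∣p∪q∣≤∣p∣+∣q∣ ⁅ f zero ⁆ (image (f ∘ suc)))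
  (≤-trans (≤-reflexive (cong (_+ ∣ image (f ∘ suc) ∣) (∣⁅x⁆∣≡1 (f zero))))
           (s≤s (∣image∣≤ (f ∘ suc))))

∈image : ∀ {n r} (f : Fin r → Fin n) j → f j ∈ image f
∈image f zero    = x∈p∪q⁺ (inj₁ (x∈⁅x⁆ (f zero)))
∈image f (suc j) = x∈p∪q⁺ (inj₂ (∈image (f ∘ suc) j))

-- Bit vectors

lookup-ext : ∀ {A : Set} {n} {xs ys : Vec A n} → (∀ i → lookup xs i ≡ lookup ys i) → xs ≡ ys
lookup-ext {xs = xs} {ys} eq =
  trans (sym (tabulate∘lookup xs)) (trans (tabulate-cong eq) (tabulate∘lookup ys))

≢true⇒≡false : ∀ {b} → b ≢ true → b ≡ false
≢true⇒≡false {true}  b≢true = ⊥-elim (b≢true refl)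
≢true⇒≡false {false} _      = refl

⇔true⇒≡ : ∀ {a b} → (a ≡ true → b ≡ true) → (b ≡ true → a ≡ true) → a ≡ b
⇔true⇒≡ {true}  a⇒b _   = sym (a⇒b refl)
⇔true⇒≡ {false} {true}  _ b⇒a = b⇒a refl
⇔true⇒≡ {false} {false} _ _   = refl

fromBits : ∀ {k} → Vec Bool k → Fin (2 ^ k)
fromBits []                    = zero
fromBits {suc k} (false ∷ bs) = fromBits bs ↑ˡ (2 ^ k + 0)
fromBits {suc k} (true ∷ bs)  = 2 ^ k ↑ʳ (fromBits bs ↑ˡ 0)

toBits : ∀ k → Fin (2 ^ k) → Vec Bool k
toBits zero    _ = []
toBits (suc k) i with splitAt (2 ^ k) i
... | inj₁ j = false ∷ toBits k j
... | inj₂ j with splitAt (2 ^ k) {0} j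
...   | inj₁ j′ = true ∷ toBits k j′
...   | inj₂ ()

toBits∘fromBits : ∀ {k} (bs : Vec Bool k) → toBits k (fromBits bs) ≡ bs
toBits∘fromBits [] = refl
toBits∘fromBits {suc k} (false ∷ bs)
  rewrite splitAt-↑ˡ (2 ^ k) (fromBits bs) (2 ^ k + 0) = cong (false ∷_) (toBits∘fromBits bs)
toBits∘fromBits {suc k} (true ∷ bs)
  rewrite splitAt-↑ʳ (2 ^ k) (2 ^ k + 0) (fromBits bs ↑ˡ 0)
        | splitAt-↑ˡ (2 ^ k) (fromBits bs) 0 = cong (true ∷_) (toBits∘fromBits bs)

fromBits∘toBits : ∀ k (i : Fin (2 ^ k)) → fromBits (toBits k i) ≡ i
fromBits∘toBits zero zero = refl
fromBits∘toBits (suc k) i with splitAt (2 ^ k) i | join-splitAt (2 ^ k) (2 ^ k + 0) i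
... | inj₁ j | joined = trans (cong (_↑ˡ (2 ^ k + 0)) (fromBits∘toBits k j)) joined
... | inj₂ j | joined with splitAt (2 ^ k) {0} j | join-splitAt (2 ^ k) 0 j
...   | inj₁ j′ | joined′ =
  trans (cong (λ z → 2 ^ k ↑ʳ (z ↑ˡ 0)) (fromBits∘toBits k j′)) (trans (cong (2 ^ k ↑ʳ_) joined′) joined)
...   | inj₂ () | _

fromBits-injective : ∀ {k} {bs cs : Vec Bool k} → fromBits bs ≡ fromBits cs → bs ≡ cs
fromBits-injective {k} {bs} {cs} eq =
  trans (sym (toBits∘fromBits bs)) (trans (cong (toBits k) eq) (toBits∘fromBits cs))

toBits-injective : ∀ {k} {i j : Fin (2 ^ k)} → toBits k i ≡ toBits k j → i ≡ j
toBits-injective {k} {i} {j} eq =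
  trans (sym (fromBits∘toBits k i)) (trans (cong fromBits eq) (fromBits∘toBits k j))

toℕ-fromBits-zeros : ∀ k → toℕ (fromBits (replicate k false)) ≡ 0
toℕ-fromBits-zeros zero    = refl
toℕ-fromBits-zeros (suc k) = trans (toℕ-↑ˡ (fromBits (replicate k false)) _) (toℕ-fromBits-zeros k)

restrict : ∀ {n} (C s : Subset n) → Vec Bool ∣ C ∣
restrict []          []      = []
restrict (false ∷ C) (_ ∷ s) = restrict C s
restrict (true ∷ C)  (b ∷ s) = b ∷ restrict C s

restrict-injective : ∀ {n} (C : Subset n) {s t : Subset n} → s ⊆ C → t ⊆ C →
                     restrict C s ≡ restrict C t → s ≡ t
restrict-injective [] {[]} {[]} _ _ _ = refl
restrict-injective (false ∷ C) {true ∷ s} s⊆C _ _ with s⊆C here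
... | ()
restrict-injective (false ∷ C) {false ∷ s} {true ∷ t} _ t⊆C _ with t⊆C here
... | ()
restrict-injective (false ∷ C) {false ∷ s} {false ∷ t} s⊆C t⊆C eq =
  cong (false ∷_) (restrict-injective C (drop-∷-⊆ s⊆C) (drop-∷-⊆ t⊆C) eq)
restrict-injective (true ∷ C) {b ∷ s} {c ∷ t} s⊆C t⊆C eq with ∷-injective eq
... | refl , eq′ = cong (b ∷_) (restrict-injective C (drop-∷-⊆ s⊆C) (drop-∷-⊆ t⊆C) eq′)

-- The empty subset of C is the extra one that makes the inequality strict.
injective-nonempty⇒<2^∣C∣ : ∀ {n m} (C : Subset m) (f : Fin n → Subset m) →
  (∀ v → f v ⊆ C) → (∀ v → ∃ λ w → w ∈ f v) → (∀ {u v} → f u ≡ f v → u ≡ v) → n < 2 ^ ∣ C ∣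
injective-nonempty⇒<2^∣C∣ {n} C f f⊆C nonempty f-injective = injective⇒≤ g-injective
  where
  code : Subset _ → Fin (2 ^ ∣ C ∣)
  code s = fromBits (restrict C s)
  g : Fin (suc n) → Fin (2 ^ ∣ C ∣)
  g zero    = code ⊥
  g (suc v) = code (f v)
  code-injective : ∀ {s t} → s ⊆ C → t ⊆ C → code s ≡ code t → s ≡ t
  code-injective s⊆C t⊆C eq = restrict-injective C s⊆C t⊆C (fromBits-injective eq)
  ⊥≢f : ∀ v → ⊥ ≢ f v
  ⊥≢f v ⊥≡fv with nonempty v
  ... | w , w∈fv = ∉⊥ (subst (w ∈_) (sym ⊥≡fv) w∈fv)
  g-injective : ∀ {u v} → g u ≡ g v → u ≡ v
  g-injective {zero}  {zero}  _  = refl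
  g-injective {zero}  {suc v} eq = ⊥-elim (⊥≢f v (code-injective ⊥⊆ (f⊆C v) eq))
  g-injective {suc u} {zero}  eq = ⊥-elim (⊥≢f u (code-injective ⊥⊆ (f⊆C u) (sym eq)))
  g-injective {suc u} {suc v} eq = cong suc (f-injective (code-injective (f⊆C u) (f⊆C v) eq))

2^m≤2^n⇒m≤n : ∀ {m n} → 2 ^ m ≤ 2 ^ n → m ≤ n
2^m≤2^n⇒m≤n 2^m≤2^n = ≮⇒≥ λ n<m → <⇒≱ (^-monoʳ-< 2 (s≤s (s≤s z≤n)) n<m) 2^m≤2^n

-- Graphs

module _ {G : Graph} where

  ∈N[]⁻ : ∀ {u w} → w ∈ N[_] {G} u → w ≡ u ⊎ Adj G u w
  ∈N[]⁻ {u} {w} w∈N[u]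
    with w ≟ᶠ u | trans (sym (lookup∘tabulate (λ x → ⌊ x ≟ᶠ u ⌋ ∨ adj G u x) w)) (∈⇒lookup w∈N[u])
  ... | yes w≡u | _    = inj₁ w≡u
  ... | no  _   | u~w  = inj₂ u~w

  ∈N[]⁺ : ∀ {u w} → w ≡ u ⊎ Adj G u w → w ∈ N[_] {G} u
  ∈N[]⁺ {u} {w} w∈N[u] = lookup⇒∈ (trans (lookup∘tabulate _ w) (bit w∈N[u]))
    where
    bit : w ≡ u ⊎ Adj G u w → ⌊ w ≟ᶠ u ⌋ ∨ adj G u w ≡ true
    bit (inj₁ refl) with w ≟ᶠ w
    ... | yes _ = refl
    ... | no w≢w = ⊥-elim (w≢w refl)
    bit (inj₂ u~w)  rewrite u~w = ∨-zeroʳ _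

  IsTDIdCode⇒n<2^∣C∣ : ∀ {C} → IsTDIdCode G C → n G < 2 ^ ∣ C ∣
  IsTDIdCode⇒n<2^∣C∣ {C} (separating , dominating) =
    injective-nonempty⇒<2^∣C∣ C (I G C) (λ v → p∩q⊆q _ C) nonempty injective
    where
    nonempty : ∀ v → ∃ λ w → w ∈ I G C v
    nonempty v with dominating v
    ... | u , v~u , u∈C = u , x∈p∩q⁺ (∈N[]⁺ (inj₂ v~u) , u∈C)
    injective : ∀ {u v} → I G C u ≡ I G C v → u ≡ v
    injective {u} {v} eq with u ≟ᶠ v
    ... | yes u≡v = u≡v
    ... | no  u≢v = ⊥-elim (separating u v u≢v eq)

  hub⇒Connected : (h : Fin (n G)) → (∀ u → Star (Adj G) u h) → Connected G
  hub⇒Connected h reach u v = reach u ◅◅ reverse Adj-sym (reach v)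
    where
    Adj-sym : ∀ {a b} → Adj G a b → Adj G b a
    Adj-sym {a} {b} a~b = trans (Graph.sym G b a) a~b

module FromRelation {n} (R : Fin n → Fin n → Set) (R? : ∀ u v → Dec (R u v))
                    (R-sym : ∀ {u v} → R u v → R v u) (R-irrefl : ∀ v → ¬ R v v) where

  graph : Graph
  graph = record
    { n      = n
    ; adj    = λ u v → does (R? u v)
    ; sym    = λ u v → does-⇔ (mk⇔ R-sym R-sym) (R? u v) (R? v u)
    ; irrefl = λ v → dec-false (R? v v) (R-irrefl v)
    }

  Adj⁻ : ∀ {u v} → Adj graph u v → R u v
  Adj⁻ {u} {v} u~v with R? u v
  ... | yes r = r

  Adj⁺ : ∀ {u v} → R u v → Adj graph u v
  Adj⁺ {u} {v} = dec-true (R? u v)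

-- The nonzero bit vectors of length k, numbered by Fin (2 ^ k ∸ 1)

module NonzeroBits (k : ℕ) where

  N : ℕ
  N = 2 ^ k ∸ 1

  2^k≡1+N : 2 ^ k ≡ suc N
  2^k≡1+N = sym (m+[n∸m]≡n (m^n>0 2 k))

  zeros : Vec Bool k
  zeros = replicate k false

  Nonzero : Vec Bool k → Set
  Nonzero X = X ≢ zeros

  opaque
    label : Fin N → Vec Bool k
    label v = toBits k (cast (sym 2^k≡1+N) (suc v))

    label-injective : ∀ {u v} → label u ≡ label v → u ≡ v
    label-injective {u} {v} eq = suc-injective (trans (sym (cast-involutive 2^k≡1+N (sym 2^k≡1+N) (suc u)))
      (trans (cong (cast 2^k≡1+N) (toBits-injective eq)) (cast-involutive 2^k≡1+N (sym 2^k≡1+N) (suc v))))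

    label-nonzero : ∀ v → Nonzero (label v)
    label-nonzero v label≡zeros with
      trans (sym (toℕ-cast (sym 2^k≡1+N) (suc v)))
        (trans (cong toℕ (sym (fromBits∘toBits k (cast (sym 2^k≡1+N) (suc v)))))
          (trans (cong (toℕ ∘ fromBits) label≡zeros) (toℕ-fromBits-zeros k)))
    ... | ()

    private
      index : Vec Bool k → Fin (suc N)
      index X = cast 2^k≡1+N (fromBits X)

      index-nonzero : ∀ {X} → Nonzero X → index X ≢ zero
      index-nonzero {X} X≢0 eq = X≢0 (fromBits-injective (toℕ-injective
        (trans (sym (toℕ-cast 2^k≡1+N (fromBits X))) (trans (cong toℕ eq) (sym (toℕ-fromBits-zeros k))))))

      pred : (i : Fin (suc N)) → i ≢ zero → Fin N
      pred zero    i≢0 = ⊥-elim (i≢0 refl)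
      pred (suc j) _   = j

      suc∘pred : ∀ (i : Fin (suc N)) (i≢0 : i ≢ zero) → Fin.suc (pred i i≢0) ≡ i
      suc∘pred zero    i≢0 = ⊥-elim (i≢0 refl)
      suc∘pred (suc j) _   = refl

    vertex : (X : Vec Bool k) → Nonzero X → Fin N
    vertex X X≢0 = pred (index X) (index-nonzero X≢0)

    label∘vertex : ∀ X (X≢0 : Nonzero X) → label (vertex X X≢0) ≡ X
    label∘vertex X X≢0 =
      trans (cong (toBits k ∘ cast (sym 2^k≡1+N)) (suc∘pred (index X) (index-nonzero X≢0)))
        (trans (cong (toBits k) (cast-involutive (sym 2^k≡1+N) 2^k≡1+N (fromBits X))) (toBits∘fromBits X))

  label≡⇒≡vertex : ∀ {w X} (X≢0 : Nonzero X) → label w ≡ X → w ≡ vertex X X≢0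
  label≡⇒≡vertex {w} {X} X≢0 eq = label-injective (trans eq (sym (label∘vertex X X≢0)))

  vertex-injective : ∀ {X Y} (X≢0 : Nonzero X) (Y≢0 : Nonzero Y) → X ≢ Y → vertex X X≢0 ≢ vertex Y Y≢0
  vertex-injective {X} {Y} X≢0 Y≢0 X≢Y eq =
    X≢Y (trans (sym (label∘vertex X X≢0)) (trans (cong label eq) (label∘vertex Y Y≢0)))

-- The labelled vertices of the construction, for k = 4 + m

module Construction (m : ℕ) where

  k : ℕ
  k = suc (suc (suc (suc m)))

  open NonzeroBits k

  V : Set
  V = Vec Bool k

  isZero : Fin k → Bool
  isZero zero    = true
  isZero (suc _) = false

  _==_ : Fin k → Fin k → Bool
  i == j = does (i ≟ᶠ j)

  c e ē : Fin k → V
  c j = tabulate λ t → isZero j ∨ isZero t ∨ (t == j)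
  e j = tabulate λ t → t == j
  ē j = tabulate λ t → not (t == j)

  ==-refl : ∀ i → (i == i) ≡ true
  ==-refl i = dec-true (i ≟ᶠ i) refl

  ==-≢ : ∀ {i j} → i ≢ j → (i == j) ≡ false
  ==-≢ {i} {j} = dec-false (i ≟ᶠ j)

  e-self : ∀ j → lookup (e j) j ≡ true
  e-self j = trans (lookup∘tabulate (_== j) j) (==-refl j)

  e-other : ∀ {j t} → t ≢ j → lookup (e j) t ≡ false
  e-other {j} {t} t≢j = trans (lookup∘tabulate (_== j) t) (==-≢ t≢j)

  ē-self : ∀ j → lookup (ē j) j ≡ false
  ē-self j = trans (lookup∘tabulate (λ t → not (t == j)) j) (cong not (==-refl j))

  ē-other : ∀ {j t} → t ≢ j → lookup (ē j) t ≡ true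
  ē-other {j} {t} t≢j = trans (lookup∘tabulate (λ t → not (t == j)) t) (cong not (==-≢ t≢j))

  c-self : ∀ j → lookup (c j) j ≡ true
  c-self j rewrite lookup∘tabulate (λ t → isZero j ∨ isZero t ∨ (t == j)) j | ==-refl j =
    trans (cong (isZero j ∨_) (∨-zeroʳ (isZero j))) (∨-zeroʳ (isZero j))

  c-zero : ∀ j → lookup (c j) zero ≡ true
  c-zero j = trans (lookup∘tabulate (λ t → isZero j ∨ isZero t ∨ (t == j)) zero) (∨-zeroʳ (isZero j))

  c₀-all : ∀ t → lookup (c zero) t ≡ true
  c₀-all t = lookup∘tabulate (λ t → true ∨ isZero t ∨ (t == zero)) t

  c-other : ∀ {j t} → j ≢ zero → t ≢ zero → t ≢ j → lookup (c j) t ≡ false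
  c-other {zero}  j≢0 _   _   = ⊥-elim (j≢0 refl)
  c-other {suc j} {zero} _ t≢0 _ = ⊥-elim (t≢0 refl)
  c-other {suc j} {suc t} _ _ t≢j = trans (lookup∘tabulate (λ t → false ∨ isZero t ∨ (t == suc j)) (suc t)) (==-≢ t≢j)

  zeros-all : ∀ t → lookup zeros t ≡ false
  zeros-all t = lookup-replicate t false

  differ-at : ∀ {X Y : V} t → lookup X t ≡ true → lookup Y t ≡ false → X ≢ Y
  differ-at t Xt Yt X≡Y with trans (sym Xt) (trans (cong (λ Z → lookup Z t) X≡Y) Yt)
  ... | ()

  nonzero-at : ∀ {X} t → lookup X t ≡ true → Nonzero X
  nonzero-at t Xt = differ-at t Xt (zeros-all t)

  -- Here k ≥ 4 is used.
  fresh : (i j : Fin k) → Σ (Fin k) λ t → t ≢ zero × t ≢ i × t ≢ j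
  fresh i j with suc (suc (suc zero)) ≟ᶠ i | suc (suc (suc zero)) ≟ᶠ j
  ... | no 3≢i | no 3≢j = suc (suc (suc zero)) , (λ ()) , 3≢i , 3≢j
  ... | yes refl | _ with suc zero ≟ᶠ j
  ...   | yes refl = suc (suc zero) , (λ ()) , (λ ()) , (λ ())
  ...   | no 1≢j   = suc zero , (λ ()) , (λ ()) , 1≢j
  fresh i j | no _ | yes refl with suc zero ≟ᶠ i
  ...   | yes refl = suc (suc zero) , (λ ()) , (λ ()) , (λ ())
  ...   | no 1≢i   = suc zero , (λ ()) , 1≢i , (λ ())

  c≢c-nonzero : ∀ {i j} → i ≢ j → j ≢ zero → c i ≢ c j
  c≢c-nonzero {i} {j} i≢j j≢0 with i ≟ᶠ zero | fresh j j
  ... | yes refl | t , t≢0 , t≢j , _ = differ-at t (c₀-all t) (c-other j≢0 t≢0 t≢j)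
  ... | no  i≢0  | _                 = differ-at i (c-self i) (c-other j≢0 i≢0 i≢j)

  c-injective : ∀ {i j} → c i ≡ c j → i ≡ j
  c-injective {i} {j} eq with i ≟ᶠ j | j ≟ᶠ zero
  ... | yes i≡j | _        = i≡j
  ... | no  i≢j | no  j≢0  = ⊥-elim (c≢c-nonzero i≢j j≢0 eq)
  ... | no  i≢j | yes refl = ⊥-elim (c≢c-nonzero (≢-sym i≢j) i≢j (sym eq))

  e-injective : ∀ {i j} → e i ≡ e j → i ≡ j
  e-injective {i} {j} eq with i ≟ᶠ j
  ... | yes i≡j = i≡j
  ... | no  i≢j = ⊥-elim (differ-at i (e-self i) (e-other i≢j) eq)

  ē-injective : ∀ {i j} → ē i ≡ ē j → i ≡ j
  ē-injective {i} {j} eq with i ≟ᶠ j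
  ... | yes i≡j = i≡j
  ... | no  i≢j = ⊥-elim (differ-at i (ē-other i≢j) (ē-self i) (sym eq))

  c≢c : ∀ {i j} → i ≢ j → c i ≢ c j
  c≢c {i} {j} i≢j = i≢j ∘ c-injective {i} {j}

  e≢e : ∀ {i j} → i ≢ j → e i ≢ e j
  e≢e {i} {j} i≢j = i≢j ∘ e-injective {i} {j}

  ē≢ē : ∀ {i j} → i ≢ j → ē i ≢ ē j
  ē≢ē {i} {j} i≢j = i≢j ∘ ē-injective {i} {j}

  c≢e : ∀ i j → c i ≢ e j
  c≢e i j with j ≟ᶠ zero | i ≟ᶠ zero
  ... | no  j≢0  | _        = differ-at zero (c-zero i) (e-other (≢-sym j≢0))
  ... | yes refl | yes refl = differ-at (suc zero) (c₀-all (suc zero)) (e-other {zero} {suc zero} (λ ()))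
  ... | yes refl | no  i≢0  = differ-at i (c-self i) (e-other i≢0)

  c≢ē : ∀ i j → c i ≢ ē j
  c≢ē i j with i ≟ᶠ zero | j ≟ᶠ zero | j ≟ᶠ i
  ... | yes refl | _        | _        = differ-at j (c₀-all j) (ē-self j)
  ... | no  _    | yes refl | _        = differ-at zero (c-zero i) (ē-self zero)
  ... | no  _    | no  _    | yes refl = differ-at j (c-self j) (ē-self j)
  ... | no  i≢0  | no  j≢0  | no  j≢i  with fresh i j
  ...   | t , t≢0 , t≢i , t≢j = ≢-sym (differ-at t (ē-other t≢j) (c-other i≢0 t≢0 t≢i))

  e≢ē : ∀ i j → e i ≢ ē j
  e≢ē i j with fresh i j
  ... | t , _ , t≢i , t≢j = ≢-sym (differ-at t (ē-other t≢j) (e-other t≢i))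

  c-nonzero : ∀ j → Nonzero (c j)
  c-nonzero j = nonzero-at j (c-self j)

  e-nonzero : ∀ j → Nonzero (e j)
  e-nonzero j = nonzero-at j (e-self j)

  ē-nonzero : ∀ j → Nonzero (ē j)
  ē-nonzero j with fresh j j
  ... | t , _ , t≢j , _ = nonzero-at t (ē-other t≢j)

  c-sym : ∀ i j → lookup (c i) j ≡ lookup (c j) i
  c-sym i j with i ≟ᶠ j | i ≟ᶠ zero | j ≟ᶠ zero
  ... | yes refl | _        | _        = refl
  ... | no  _    | yes refl | _        = trans (c₀-all j) (sym (c-zero j))
  ... | no  _    | no  _    | yes refl = trans (c-zero i) (sym (c₀-all i))
  ... | no  i≢j  | no  i≢0  | no  j≢0  = trans (c-other i≢0 j≢0 (≢-sym i≢j)) (sym (c-other j≢0 i≢0 i≢j))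

  data Edge (X Y : V) : Set where
    code : ∀ i → X ≡ c i → lookup Y i ≡ true → Edge X Y
    twin : ∀ i → X ≡ e i → Y ≡ ē i → Edge X Y

  edge? : ∀ X Y → Dec (Edge X Y)
  edge? X Y = map′ fromSum toSum
    (any? (λ i → ≡-dec _≟ᴮ_ X (c i) ×-dec (lookup Y i ≟ᴮ true))
     ⊎-dec any? (λ i → ≡-dec _≟ᴮ_ X (e i) ×-dec ≡-dec _≟ᴮ_ Y (ē i)))
    where
    Sum : Set
    Sum = (∃ λ i → X ≡ c i × lookup Y i ≡ true) ⊎ (∃ λ i → X ≡ e i × Y ≡ ē i)
    fromSum : Sum → Edge X Y
    fromSum (inj₁ (i , X≡c , Yi)) = code i X≡c Yi
    fromSum (inj₂ (i , X≡e , Y≡ē)) = twin i X≡e Y≡ē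
    toSum : Edge X Y → Sum
    toSum (code i X≡c Yi) = inj₁ (i , X≡c , Yi)
    toSum (twin i X≡e Y≡ē) = inj₂ (i , X≡e , Y≡ē)

  Rel : V → V → Set
  Rel X Y = Edge X Y ⊎ Edge Y X

  Nb : V → V → Set
  Nb X Z = Z ≡ X ⊎ Rel X Z

  Nb-self : ∀ {X} → Nb X X
  Nb-self = inj₁ refl

  Nb-sym : ∀ {X Z} → Nb X Z → Nb Z X
  Nb-sym (inj₁ refl)      = inj₁ refl
  Nb-sym (inj₂ (inj₁ xz)) = inj₂ (inj₂ xz)
  Nb-sym (inj₂ (inj₂ zx)) = inj₂ (inj₁ zx)

  Nb⇒Nonzero : ∀ {X Z} → Nonzero X → Nb X Z → Nonzero Z
  Nb⇒Nonzero X≢0 (inj₁ refl) = X≢0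
  Nb⇒Nonzero _ (inj₂ (inj₁ (code i _ Zi))) refl with trans (sym Zi) (zeros-all i)
  ... | ()
  Nb⇒Nonzero _ (inj₂ (inj₁ (twin i _ Z≡ē))) refl = ē-nonzero i (sym Z≡ē)
  Nb⇒Nonzero _ (inj₂ (inj₂ (code i Z≡c _))) refl = c-nonzero i (sym Z≡c)
  Nb⇒Nonzero _ (inj₂ (inj₂ (twin i Z≡e _))) refl = e-nonzero i (sym Z≡e)

  Nb-c⁻ : ∀ {i Z} → Nb (c i) Z → lookup Z i ≡ true
  Nb-c⁻ {i} (inj₁ refl) = c-self i
  Nb-c⁻ {i} (inj₂ (inj₁ (code j c≡c Zj))) with refl ← c-injective {i} {j} c≡c = Zj
  Nb-c⁻ {i} (inj₂ (inj₁ (twin j c≡e _))) = ⊥-elim (c≢e i j c≡e)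
  Nb-c⁻ {i} (inj₂ (inj₂ (code j refl ci))) = trans (sym (c-sym i j)) ci
  Nb-c⁻ {i} (inj₂ (inj₂ (twin j _ c≡ē))) = ⊥-elim (c≢ē i j c≡ē)

  Nb-c⁺ : ∀ {i Z} → lookup Z i ≡ true → Nb (c i) Z
  Nb-c⁺ {i} Zi = inj₂ (inj₁ (code i refl Zi))

  ¬Nb-c : ∀ {i Z} → lookup Z i ≡ false → ¬ Nb (c i) Z
  ¬Nb-c Zi nb with trans (sym (Nb-c⁻ nb)) Zi
  ... | ()

  Nb-e⁻ : ∀ {i Z} → Nb (e i) Z → OneOf₃ (e i) (c i) (ē i) Z
  Nb-e⁻ (inj₁ Z≡e) = inj₁ Z≡e
  Nb-e⁻ {i} (inj₂ (inj₁ (code j e≡c _))) = ⊥-elim (c≢e j i (sym e≡c))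
  Nb-e⁻ {i} (inj₂ (inj₁ (twin j e≡e Z≡ē))) with refl ← e-injective {i} {j} e≡e = inj₂ (inj₂ Z≡ē)
  Nb-e⁻ {i} (inj₂ (inj₂ (code j Z≡c ej))) with j ≟ᶠ i
  ... | yes refl = inj₂ (inj₁ Z≡c)
  ... | no  j≢i with trans (sym ej) (e-other j≢i)
  ...   | ()
  Nb-e⁻ {i} (inj₂ (inj₂ (twin j _ e≡ē))) = ⊥-elim (e≢ē i j e≡ē)

  ¬Nb-e : ∀ {i Z} → Z ≢ e i → Z ≢ c i → Z ≢ ē i → ¬ Nb (e i) Z
  ¬Nb-e Z≢e Z≢c Z≢ē nb with Nb-e⁻ nb
  ... | inj₁ Z≡e          = Z≢e Z≡e
  ... | inj₂ (inj₁ Z≡c)   = Z≢c Z≡c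
  ... | inj₂ (inj₂ Z≡ē)   = Z≢ē Z≡ē

  Nb-e-c : ∀ i → Nb (e i) (c i)
  Nb-e-c i = Nb-sym (Nb-c⁺ (e-self i))

  Nb-e-ē : ∀ i → Nb (e i) (ē i)
  Nb-e-ē i = inj₂ (inj₁ (twin i refl refl))

  Nb-ē⁻ : ∀ {i Z} → Nb (ē i) Z → Z ≡ ē i ⊎ Z ≡ e i ⊎ ∃ λ j → j ≢ i × Z ≡ c j
  Nb-ē⁻ (inj₁ Z≡ē) = inj₁ Z≡ē
  Nb-ē⁻ {i} (inj₂ (inj₁ (code j ē≡c _))) = ⊥-elim (c≢ē j i (sym ē≡c))
  Nb-ē⁻ {i} (inj₂ (inj₁ (twin j ē≡e _))) = ⊥-elim (e≢ē j i (sym ē≡e))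
  Nb-ē⁻ {i} (inj₂ (inj₂ (code j Z≡c ēj))) = inj₂ (inj₂ (j , j≢i , Z≡c))
    where
    j≢i : j ≢ i
    j≢i refl with trans (sym ēj) (ē-self j)
    ... | ()
  Nb-ē⁻ {i} (inj₂ (inj₂ (twin j Z≡e ē≡ē))) with refl ← ē-injective {i} {j} ē≡ē = inj₂ (inj₁ Z≡e)

  ¬Nb-ē : ∀ i {Z} → Z ≢ ē i → Z ≢ e i → (∀ j → j ≢ i → Z ≢ c j) → ¬ Nb (ē i) Z
  ¬Nb-ē _ Z≢ē Z≢e Z≢c nb with Nb-ē⁻ nb
  ... | inj₁ Z≡ē                    = Z≢ē Z≡ē
  ... | inj₂ (inj₁ Z≡e)             = Z≢e Z≡e
  ... | inj₂ (inj₂ (j , j≢i , Z≡c)) = Z≢c j j≢i Z≡c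

  Nb-ē-e : ∀ i → Nb (ē i) (e i)
  Nb-ē-e i = inj₂ (inj₂ (twin i refl refl))

  Nb-ē-c : ∀ {i j} → j ≢ i → Nb (ē i) (c j)
  Nb-ē-c j≢i = Nb-sym (Nb-c⁺ (ē-other j≢i))

  record Ordinary (X : V) : Set where
    constructor ordinary
    field
      nonzero : Nonzero X
      ≢c      : ∀ i → X ≢ c i
      ≢e      : ∀ i → X ≢ e i
      ≢ē      : ∀ i → X ≢ ē i

  Nb-ord⁻ : ∀ {X Z} → Ordinary X → Nb X Z → Z ≡ X ⊎ ∃ λ j → Z ≡ c j × lookup X j ≡ true
  Nb-ord⁻ _ (inj₁ Z≡X) = inj₁ Z≡X
  Nb-ord⁻ o (inj₂ (inj₁ (code j X≡c _))) = ⊥-elim (Ordinary.≢c o j X≡c)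
  Nb-ord⁻ o (inj₂ (inj₁ (twin j X≡e _))) = ⊥-elim (Ordinary.≢e o j X≡e)
  Nb-ord⁻ _ (inj₂ (inj₂ (code j Z≡c Xj))) = inj₂ (j , Z≡c , Xj)
  Nb-ord⁻ o (inj₂ (inj₂ (twin j _ X≡ē))) = ⊥-elim (Ordinary.≢ē o j X≡ē)

  ¬Nb-ord : ∀ {X Z} → Ordinary X → Z ≢ X → (∀ j → Z ≡ c j → lookup X j ≢ true) → ¬ Nb X Z
  ¬Nb-ord o Z≢X Z≢c nb with Nb-ord⁻ o nb
  ... | inj₁ Z≡X             = Z≢X Z≡X
  ... | inj₂ (j , Z≡c , Xj) = Z≢c j Z≡c Xj

  Nb-bit : ∀ {X j} → lookup X j ≡ true → Nb X (c j)
  Nb-bit Xj = Nb-sym (Nb-c⁺ Xj)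

  data Kind : V → Set where
    is-c  : ∀ i → Kind (c i)
    is-e  : ∀ i → Kind (e i)
    is-ē  : ∀ i → Kind (ē i)
    other : ∀ {X} → Ordinary X → Kind X

  classify : ∀ X → Nonzero X → Kind X
  classify X X≢0
    with any? (λ i → ≡-dec _≟ᴮ_ X (c i)) | any? (λ i → ≡-dec _≟ᴮ_ X (e i)) | any? (λ i → ≡-dec _≟ᴮ_ X (ē i))
  ... | yes (i , refl) | _              | _              = is-c i
  ... | no _           | yes (i , refl) | _              = is-e i
  ... | no _           | no _           | yes (i , refl) = is-ē i
  ... | no ¬c          | no ¬e          | no ¬ē          =
    other (ordinary X≢0 (λ i p → ¬c (i , p)) (λ i p → ¬e (i , p)) (λ i p → ¬ē (i , p)))

  e≢c : ∀ i j → e i ≢ c j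
  e≢c i j = ≢-sym (c≢e j i)

  ē≢c : ∀ i j → ē i ≢ c j
  ē≢c i j = ≢-sym (c≢ē j i)

  ē≢e : ∀ i j → ē i ≢ e j
  ē≢e i j = ≢-sym (e≢ē j i)

  ¬Nb-bit : ∀ {X j} → lookup X j ≡ false → ¬ Nb X (c j)
  ¬Nb-bit Xj = ¬Nb-c Xj ∘ Nb-sym

  c-neighbour : ∀ j → ∃ λ x → x ≢ j × lookup (c x) j ≡ true
  c-neighbour zero    = suc zero , (λ ()) , c-zero (suc zero)
  c-neighbour (suc j) = zero , (λ ()) , c₀-all (suc j)

  set-bit : ∀ {X} → Nonzero X → ∃ λ a → lookup X a ≡ true
  set-bit {X} X≢0 with any? (λ t → lookup X t ≟ᴮ true)
  ... | yes bit = bit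
  ... | no  ¬bit = ⊥-elim (X≢0 (lookup-ext λ t →
    trans (≢true⇒≡false (λ Xt → ¬bit (t , Xt))) (sym (zeros-all t))))

  only-bit⇒≡e : ∀ {X a} → lookup X a ≡ true → (∀ b → b ≢ a → lookup X b ≡ false) → X ≡ e a
  only-bit⇒≡e {X} {a} Xa others = lookup-ext bitwise
    where
    bitwise : ∀ t → lookup X t ≡ lookup (e a) t
    bitwise t with t ≟ᶠ a
    ... | yes refl = trans Xa (sym (e-self a))
    ... | no  t≢a  = trans (others t t≢a) (sym (e-other t≢a))

  two-set-bits : ∀ {X} → Ordinary X → Σ (Fin k) λ a → Σ (Fin k) λ b →
                 a ≢ b × lookup X a ≡ true × lookup X b ≡ true
  two-set-bits {X} o with set-bit (Ordinary.nonzero o)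
  ... | a , Xa with any? (λ b → ¬? (b ≟ᶠ a) ×-dec (lookup X b ≟ᴮ true))
  ...   | yes (b , b≢a , Xb) = a , b , ≢-sym b≢a , Xa , Xb
  ...   | no  ¬other = ⊥-elim (Ordinary.≢e o a (only-bit⇒≡e Xa λ b b≢a →
           ≢true⇒≡false (λ Xb → ¬other (b , b≢a , Xb))))

  differing-bit : ∀ {X Y : V} → X ≢ Y → ∃ λ t → lookup X t ≢ lookup Y t
  differing-bit {X} {Y} X≢Y with any? (λ t → ¬? (lookup X t ≟ᴮ lookup Y t))
  ... | yes t = t
  ... | no  ¬t = ⊥-elim (X≢Y (lookup-ext bitwise))
    where
    bitwise : ∀ t → lookup X t ≡ lookup Y t
    bitwise t with lookup X t ≟ᴮ lookup Y t
    ... | yes eq = eq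
    ... | no  ne = ⊥-elim (¬t (t , ne))

  record Three (P : V → Set) : Set where
    constructor three
    field
      z₁ z₂ z₃ : V
      z₁≢z₂    : z₁ ≢ z₂
      z₁≢z₃    : z₁ ≢ z₃
      z₂≢z₃    : z₂ ≢ z₃
      p₁       : P z₁
      p₂       : P z₂
      p₃       : P z₃

  InΔ : V → V → V → Set
  InΔ X Y Z = (Nb X Z × ¬ Nb Y Z) ⊎ (¬ Nb X Z × Nb Y Z)

  inˡ : ∀ {X Y Z} → Nb X Z → ¬ Nb Y Z → InΔ X Y Z
  inˡ x y = inj₁ (x , y)

  inʳ : ∀ {X Y Z} → ¬ Nb X Z → Nb Y Z → InΔ X Y Z
  inʳ x y = inj₂ (x , y)

  InΔ-sym : ∀ {X Y Z} → InΔ X Y Z → InΔ Y X Z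
  InΔ-sym (inj₁ (x , y)) = inj₂ (y , x)
  InΔ-sym (inj₂ (x , y)) = inj₁ (y , x)

  InΔ⇒Nonzero : ∀ {X Y Z} → Nonzero X → Nonzero Y → InΔ X Y Z → Nonzero Z
  InΔ⇒Nonzero X≢0 _ (inj₁ (nb , _)) = Nb⇒Nonzero X≢0 nb
  InΔ⇒Nonzero _ Y≢0 (inj₂ (_ , nb)) = Nb⇒Nonzero Y≢0 nb

  Three-InΔ-sym : ∀ {X Y} → Three (InΔ X Y) → Three (InΔ Y X)
  Three-InΔ-sym (three z₁ z₂ z₃ d₁₂ d₁₃ d₂₃ p₁ p₂ p₃) =
    three z₁ z₂ z₃ d₁₂ d₁₃ d₂₃ (InΔ-sym p₁) (InΔ-sym p₂) (InΔ-sym p₃)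

  Nb-three : ∀ X → Nonzero X → Three (Nb X)
  Nb-three X X≢0 with classify X X≢0
  ... | is-c i with fresh i i
  ...   | t , _ , t≢i , _ = three (c i) (e i) (ē t) (c≢e i i) (c≢ē i t) (e≢ē i t)
                              Nb-self (Nb-c⁺ (e-self i)) (Nb-c⁺ (ē-other (≢-sym t≢i)))
  Nb-three X X≢0 | is-e i = three (e i) (c i) (ē i) (e≢c i i) (e≢ē i i) (c≢ē i i)
                              Nb-self (Nb-e-c i) (Nb-e-ē i)
  Nb-three X X≢0 | is-ē i with fresh i i
  ...   | t , _ , t≢i , _ = three (ē i) (e i) (c t) (ē≢e i i) (ē≢c i t) (e≢c i t)
                              Nb-self (Nb-ē-e i) (Nb-ē-c t≢i)
  Nb-three X X≢0 | other o with two-set-bits o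
  ...   | a , b , a≢b , Xa , Xb = three X (c a) (c b) (Ordinary.≢c o a) (Ordinary.≢c o b)
                                    (c≢c a≢b) Nb-self (Nb-bit Xa) (Nb-bit Xb)

  separate-c-c : ∀ {i j} → i ≢ j → Three (InΔ (c i) (c j))
  separate-c-c {i} {j} i≢j = three (e i) (ē j) (e j) (e≢ē i j) (e≢e i≢j) (ē≢e j j)
    (inˡ (Nb-c⁺ (e-self i)) (¬Nb-c (e-other (≢-sym i≢j))))
    (inˡ (Nb-c⁺ (ē-other i≢j)) (¬Nb-c (ē-self j)))
    (inʳ (¬Nb-c (e-other i≢j)) (Nb-c⁺ (e-self j)))

  separate-c-e : ∀ j i → Three (InΔ (c j) (e i))
  separate-c-e j i with i ≟ᶠ j
  ... | no i≢j with fresh j i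
  ...   | a , _ , a≢j , a≢i = three (c j) (e j) (ē a) (c≢e j j) (c≢ē j a) (e≢ē j a)
    (inˡ Nb-self (¬Nb-e (c≢e j i) (c≢c (≢-sym i≢j)) (c≢ē j i)))
    (inˡ (Nb-c⁺ (e-self j)) (¬Nb-e (e≢e (≢-sym i≢j)) (e≢c j i) (e≢ē j i)))
    (inˡ (Nb-c⁺ (ē-other (≢-sym a≢j))) (¬Nb-e (ē≢e a i) (ē≢c a i) (ē≢ē a≢i)))
  separate-c-e j i | yes refl with fresh i i | c-neighbour i
  ... | a , _ , a≢i , _ | x , x≢i , cx[i] = three (ē i) (c x) (ē a) (ē≢c i x) (ē≢ē (≢-sym a≢i)) (c≢ē x a)
    (inʳ (¬Nb-c (ē-self i)) (Nb-e-ē i))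
    (inˡ (Nb-c⁺ cx[i]) (¬Nb-e (c≢e x i) (c≢c x≢i) (c≢ē x i)))
    (inˡ (Nb-c⁺ (ē-other (≢-sym a≢i))) (¬Nb-e (ē≢e a i) (ē≢c a i) (ē≢ē a≢i)))

  separate-c-ē : ∀ j i → Three (InΔ (c j) (ē i))
  separate-c-ē j i with j ≟ᶠ i
  ... | no j≢i with fresh j i
  ...   | a , _ , a≢j , a≢i = three (e j) (e i) (ē a) (e≢e j≢i) (e≢ē j a) (e≢ē i a)
    (inˡ (Nb-c⁺ (e-self j)) (¬Nb-ē i (e≢ē j i) (e≢e j≢i) (λ t _ → e≢c j t)))
    (inʳ (¬Nb-c (e-other j≢i)) (Nb-ē-e i))
    (inˡ (Nb-c⁺ (ē-other (≢-sym a≢j))) (¬Nb-ē i (ē≢ē a≢i) (ē≢e a i) (λ t _ → ē≢c a t)))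
  separate-c-ē j i | yes refl with fresh j j
  ... | a , _ , a≢j , _ = three (c j) (ē j) (ē a) (c≢ē j j) (c≢ē j a) (ē≢ē (≢-sym a≢j))
    (inˡ Nb-self (¬Nb-ē j (c≢ē j j) (c≢e j j) (λ t t≢j → c≢c (≢-sym t≢j))))
    (inʳ (¬Nb-c (ē-self j)) Nb-self)
    (inˡ (Nb-c⁺ (ē-other (≢-sym a≢j))) (¬Nb-ē j (ē≢ē a≢j) (ē≢e a j) (λ t _ → ē≢c a t)))

  separate-c-ord : ∀ j {X} → Ordinary X → Three (InΔ (c j) X)
  separate-c-ord j {X} o with fresh j j
  ... | a , _ , a≢j , _ with fresh j a
  ...   | b , _ , b≢j , b≢a = three (e j) (ē a) (ē b) (e≢ē j a) (e≢ē j b) (ē≢ē (≢-sym b≢a))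
    (inˡ (Nb-c⁺ (e-self j)) (¬Nb-ord o (Ordinary.≢e o j ∘ sym) (λ t eq _ → e≢c j t eq)))
    (inˡ (Nb-c⁺ (ē-other (≢-sym a≢j))) (¬Nb-ord o (Ordinary.≢ē o a ∘ sym) (λ t eq _ → ē≢c a t eq)))
    (inˡ (Nb-c⁺ (ē-other (≢-sym b≢j))) (¬Nb-ord o (Ordinary.≢ē o b ∘ sym) (λ t eq _ → ē≢c b t eq)))

  separate-e-e : ∀ {i j} → i ≢ j → Three (InΔ (e i) (e j))
  separate-e-e {i} {j} i≢j = three (e i) (e j) (c i) (e≢e i≢j) (e≢c i i) (e≢c j i)
    (inˡ Nb-self (¬Nb-e (e≢e i≢j) (e≢c i j) (e≢ē i j)))
    (inʳ (¬Nb-e (e≢e (≢-sym i≢j)) (e≢c j i) (e≢ē j i)) Nb-self)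
    (inˡ (Nb-e-c i) (¬Nb-e (c≢e i j) (c≢c i≢j) (c≢ē i j)))

  separate-e-ē : ∀ i j → Three (InΔ (e i) (ē j))
  separate-e-ē i j with i ≟ᶠ j
  ... | no i≢j = three (e i) (ē i) (ē j) (e≢ē i i) (e≢ē i j) (ē≢ē i≢j)
    (inˡ Nb-self (¬Nb-ē j (e≢ē i j) (e≢e i≢j) (λ t _ → e≢c i t)))
    (inˡ (Nb-e-ē i) (¬Nb-ē j (ē≢ē i≢j) (ē≢e i j) (λ t _ → ē≢c i t)))
    (inʳ (¬Nb-e (ē≢e j i) (ē≢c j i) (ē≢ē (≢-sym i≢j))) Nb-self)
  ... | yes refl with fresh i i
  ...   | a , _ , a≢i , _ with fresh i a
  ...     | b , _ , b≢i , b≢a = three (c i) (c a) (c b) (c≢c (≢-sym a≢i))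
                                  (c≢c (≢-sym b≢i)) (c≢c (≢-sym b≢a))
    (inˡ (Nb-e-c i) (¬Nb-ē i (c≢ē i i) (c≢e i i) (λ t t≢i → c≢c (≢-sym t≢i))))
    (inʳ (¬Nb-e (c≢e a i) (c≢c a≢i) (c≢ē a i)) (Nb-ē-c a≢i))
    (inʳ (¬Nb-e (c≢e b i) (c≢c b≢i) (c≢ē b i)) (Nb-ē-c b≢i))

  separate-e-ord : ∀ i {X} → Ordinary X → Three (InΔ (e i) X)
  separate-e-ord i {X} o = three (e i) (ē i) X (e≢ē i i) (Ordinary.≢e o i ∘ sym) (Ordinary.≢ē o i ∘ sym)
    (inˡ Nb-self (¬Nb-ord o (Ordinary.≢e o i ∘ sym) (λ t eq _ → e≢c i t eq)))
    (inˡ (Nb-e-ē i) (¬Nb-ord o (Ordinary.≢ē o i ∘ sym) (λ t eq _ → ē≢c i t eq)))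
    (inʳ (¬Nb-e (Ordinary.≢e o i) (Ordinary.≢c o i) (Ordinary.≢ē o i)) Nb-self)

  separate-ē-ē : ∀ {i j} → i ≢ j → Three (InΔ (ē i) (ē j))
  separate-ē-ē {i} {j} i≢j = three (ē i) (e i) (ē j) (ē≢e i i) (ē≢ē i≢j) (e≢ē i j)
    (inˡ Nb-self (¬Nb-ē j (ē≢ē i≢j) (ē≢e i j) (λ t _ → ē≢c i t)))
    (inˡ (Nb-ē-e i) (¬Nb-ē j (e≢ē i j) (e≢e i≢j) (λ t _ → e≢c i t)))
    (inʳ (¬Nb-ē i (ē≢ē (≢-sym i≢j)) (ē≢e j i) (λ t _ → ē≢c j t)) Nb-self)

  separate-ē-ord : ∀ i {X} → Ordinary X → Three (InΔ (ē i) X)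
  separate-ē-ord i {X} o = three (ē i) (e i) X (ē≢e i i) (Ordinary.≢ē o i ∘ sym) (Ordinary.≢e o i ∘ sym)
    (inˡ Nb-self (¬Nb-ord o (Ordinary.≢ē o i ∘ sym) (λ t eq _ → ē≢c i t eq)))
    (inˡ (Nb-ē-e i) (¬Nb-ord o (Ordinary.≢e o i ∘ sym) (λ t eq _ → e≢c i t eq)))
    (inʳ (¬Nb-ē i (Ordinary.≢ē o i) (Ordinary.≢e o i) (λ t _ → Ordinary.≢c o t)) Nb-self)

  separate-by-bit : ∀ {X Y t} → Ordinary X → Ordinary Y → X ≢ Y →
                    lookup X t ≡ true → lookup Y t ≡ false → Three (InΔ X Y)
  separate-by-bit {X} {Y} {t} oX oY X≢Y Xt Yt = three X Y (c t) X≢Y (Ordinary.≢c oX t) (Ordinary.≢c oY t)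
    (inˡ Nb-self (¬Nb-ord oY X≢Y (λ j X≡c _ → Ordinary.≢c oX j X≡c)))
    (inʳ (¬Nb-ord oX (≢-sym X≢Y) (λ j Y≡c _ → Ordinary.≢c oY j Y≡c)) Nb-self)
    (inˡ (Nb-bit Xt) (¬Nb-bit Yt))

  separate-ord-ord : ∀ {X Y} → Ordinary X → Ordinary Y → X ≢ Y → Three (InΔ X Y)
  separate-ord-ord {X} {Y} oX oY X≢Y with differing-bit X≢Y
  ... | t , Xt≢Yt with lookup X t in Xt | lookup Y t in Yt
  ...   | true  | true  = ⊥-elim (Xt≢Yt refl)
  ...   | false | false = ⊥-elim (Xt≢Yt refl)
  ...   | true  | false = separate-by-bit oX oY X≢Y Xt Yt
  ...   | false | true  = Three-InΔ-sym (separate-by-bit oY oX (≢-sym X≢Y) Yt Xt)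

  separate : ∀ X Y → Nonzero X → Nonzero Y → X ≢ Y → Three (InΔ X Y)
  separate X Y X≢0 Y≢0 X≢Y with classify X X≢0 | classify Y Y≢0
  ... | is-c i  | is-c j  = separate-c-c {i} {j} (X≢Y ∘ cong c)
  ... | is-c i  | is-e j  = separate-c-e i j
  ... | is-c i  | is-ē j  = separate-c-ē i j
  ... | is-c i  | other o = separate-c-ord i o
  ... | is-e i  | is-c j  = Three-InΔ-sym (separate-c-e j i)
  ... | is-e i  | is-e j  = separate-e-e {i} {j} (X≢Y ∘ cong e)
  ... | is-e i  | is-ē j  = separate-e-ē i j
  ... | is-e i  | other o = separate-e-ord i o
  ... | is-ē i  | is-c j  = Three-InΔ-sym (separate-c-ē j i)
  ... | is-ē i  | is-e j  = Three-InΔ-sym (separate-e-ē j i)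
  ... | is-ē i  | is-ē j  = separate-ē-ē {i} {j} (X≢Y ∘ cong ē)
  ... | is-ē i  | other o = separate-ē-ord i o
  ... | other o | is-c j  = Three-InΔ-sym (separate-c-ord j o)
  ... | other o | is-e j  = Three-InΔ-sym (separate-e-ord j o)
  ... | other o | is-ē j  = Three-InΔ-sym (separate-ē-ord j o)
  ... | other o | other p = separate-ord-ord o p X≢Y

  Cover : (V → Set) → V → V → V → Set
  Cover P X A B = ∀ Z → P Z → OneOf₃ X A B Z

  -- An error-correcting code meets the covered set in at least three vertices, so contains X.
  data Forced (X : V) : Set where
    by-Nb : ∀ U A B → Nonzero U → Nonzero A → Nonzero B → Cover (Nb U) X A B → Forced X
    by-Δ  : ∀ U W A B → Nonzero U → Nonzero W → Nonzero A → Nonzero B → U ≢ W →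
            Cover (InΔ U W) X A B → Forced X

  clear : Fin k → V → V
  clear a X = tabulate λ t → not (t == a) ∧ lookup X t

  clear-self : ∀ a X → lookup (clear a X) a ≡ false
  clear-self a X = trans (lookup∘tabulate (λ t → not (t == a) ∧ lookup X t) a)
                         (cong (λ b → not b ∧ lookup X a) (==-refl a))

  clear-other : ∀ {a t} X → t ≢ a → lookup (clear a X) t ≡ lookup X t
  clear-other {a} {t} X t≢a = trans (lookup∘tabulate (λ t → not (t == a) ∧ lookup X t) t)
                                    (cong (λ b → not b ∧ lookup X t) (==-≢ t≢a))

  -- Leaving bit zero unset ensures that the cleared label is not a code label.
  set-bit-preferring-zero : ∀ {X} → Nonzero X →
    ∃ λ a → lookup X a ≡ true × lookup (clear a X) zero ≡ false
  set-bit-preferring-zero {X} X≢0 with lookup X zero ≟ᴮ true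
  ... | yes X₀ = zero , X₀ , clear-self zero X
  ... | no  X₀≢true with set-bit X≢0
  ...   | zero  , X₀ = ⊥-elim (X₀≢true X₀)
  ...   | suc a , Xa = suc a , Xa , trans (clear-other {suc a} X (λ ())) (≢true⇒≡false X₀≢true)

  clear-unit-or-ordinary : ∀ {X a} → Ordinary X → lookup X a ≡ true → lookup (clear a X) zero ≡ false →
                           (∃ λ b → clear a X ≡ e b) ⊎ Ordinary (clear a X)
  clear-unit-or-ordinary {X} {a} o Xa Y₀ with any? (λ b → ≡-dec _≟ᴮ_ (clear a X) (e b))
  ... | yes unit = inj₁ unit
  ... | no  ¬unit = inj₂ (ordinary Y≢0 (λ i → ≢-sym (differ-at zero (c-zero i) Y₀)) (λ b eq → ¬unit (b , eq)) Y≢ē)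
    where
    Y≢0 : Nonzero (clear a X)
    Y≢0 Y≡0 = Ordinary.≢e o a (only-bit⇒≡e Xa λ b b≢a →
      trans (sym (clear-other X b≢a)) (trans (cong (λ Z → lookup Z b) Y≡0) (zeros-all b)))
    Y≢ē : ∀ i → clear a X ≢ ē i
    Y≢ē i with a ≟ᶠ i
    ... | no  a≢i  = ≢-sym (differ-at {ē i} {clear a X} a (ē-other a≢i) (clear-self a X))
    ... | yes refl = λ Y≡ē → Ordinary.≢c o zero (lookup-ext (bitwise Y≡ē))
      where
      bitwise : clear a X ≡ ē a → ∀ t → lookup X t ≡ lookup (c zero) t
      bitwise Y≡ē t with t ≟ᶠ a
      ... | yes refl = trans Xa (sym (c₀-all t))
      ... | no  t≢a  = trans (sym (clear-other X t≢a))
                         (trans (cong (λ Z → lookup Z t) Y≡ē) (trans (ē-other t≢a) (sym (c₀-all t))))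

  Nb-cover-two-bits : ∀ {X a b} → Ordinary X → clear a X ≡ e b → Cover (Nb X) X (c a) (c b)
  Nb-cover-two-bits {X} {a} {b} o Y≡e Z nb with Nb-ord⁻ o nb
  ... | inj₁ Z≡X = inj₁ Z≡X
  ... | inj₂ (j , Z≡c , Xj) with j ≟ᶠ a | j ≟ᶠ b
  ...   | yes refl | _        = inj₂ (inj₁ Z≡c)
  ...   | no  _    | yes refl = inj₂ (inj₂ Z≡c)
  ...   | no  j≢a  | no  j≢b  = ⊥-elim (differ-at {X} {X} j Xj
          (trans (sym (clear-other X j≢a)) (trans (cong (λ Y → lookup Y j) Y≡e) (e-other j≢b))) refl)

  InΔ-cover-clear : ∀ {X a} → Ordinary X → Ordinary (clear a X) → Cover (InΔ X (clear a X)) X (clear a X) (c a)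
  InΔ-cover-clear {X} {a} oX oY Z (inj₁ (nbX , ¬nbY)) with Nb-ord⁻ oX nbX
  ... | inj₁ Z≡X = inj₁ Z≡X
  ... | inj₂ (j , refl , Xj) with j ≟ᶠ a
  ...   | yes refl = inj₂ (inj₂ refl)
  ...   | no  j≢a  = ⊥-elim (¬nbY (Nb-bit (trans (clear-other X j≢a) Xj)))
  InΔ-cover-clear {X} {a} oX oY Z (inj₂ (¬nbX , nbY)) with Nb-ord⁻ oY nbY
  ... | inj₁ Z≡Y = inj₂ (inj₁ Z≡Y)
  ... | inj₂ (j , refl , Yj) with j ≟ᶠ a
  ...   | yes refl = ⊥-elim (differ-at {clear j X} {clear j X} j Yj (clear-self j X) refl)
  ...   | no  j≢a  = ⊥-elim (¬nbX (Nb-bit (trans (sym (clear-other X j≢a)) Yj)))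

  forced-ordinary : ∀ {X} → Ordinary X → Forced X
  forced-ordinary {X} o with set-bit-preferring-zero (Ordinary.nonzero o)
  ... | a , Xa , Y₀ with clear-unit-or-ordinary o Xa Y₀
  ...   | inj₁ (b , Y≡e) =
    by-Nb X (c a) (c b) (Ordinary.nonzero o) (c-nonzero a) (c-nonzero b) (Nb-cover-two-bits o Y≡e)
  ...   | inj₂ oY =
    by-Δ X (clear a X) (clear a X) (c a) (Ordinary.nonzero o) (Ordinary.nonzero oY) (Ordinary.nonzero oY)
         (c-nonzero a) (differ-at {X} {clear a X} a Xa (clear-self a X)) (InΔ-cover-clear o oY)

  forced : ∀ X → Nonzero X → Forced X
  forced X X≢0 with classify X X≢0
  ... | is-c i  = by-Nb (e i) (e i) (ē i) (e-nonzero i) (e-nonzero i) (ē-nonzero i) (λ Z → OneOf₃-swap₁₂ ∘ Nb-e⁻)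
  ... | is-e i  = by-Nb (e i) (c i) (ē i) (e-nonzero i) (c-nonzero i) (ē-nonzero i) (λ Z → Nb-e⁻)
  ... | is-ē i  = by-Nb (e i) (c i) (e i) (e-nonzero i) (c-nonzero i) (e-nonzero i) (λ Z → OneOf₃-swap₁₃ ∘ Nb-e⁻)
  ... | other o = forced-ordinary o

  Adjacent : V → V → Set
  Adjacent X Y = X ≢ Y × Rel X Y

  Adjacentᶠ : Fin N → Fin N → Set
  Adjacentᶠ u v = Adjacent (label u) (label v)

  adjacentᶠ? : ∀ u v → Dec (Adjacentᶠ u v)
  adjacentᶠ? u v = ¬? (≡-dec _≟ᴮ_ (label u) (label v)) ×-dec (edge? (label u) (label v) ⊎-dec edge? (label v) (label u))

  Adjacent-sym : ∀ {X Y} → Adjacent X Y → Adjacent Y X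
  Adjacent-sym (X≢Y , inj₁ xy) = ≢-sym X≢Y , inj₂ xy
  Adjacent-sym (X≢Y , inj₂ yx) = ≢-sym X≢Y , inj₁ yx

  Adjacentᶠ-irrefl : ∀ v → ¬ Adjacentᶠ v v
  Adjacentᶠ-irrefl v v~v = proj₁ v~v refl

  open FromRelation Adjacentᶠ adjacentᶠ? Adjacent-sym Adjacentᶠ-irrefl using (Adj⁻; Adj⁺)

  G : Graph
  G = FromRelation.graph Adjacentᶠ adjacentᶠ? Adjacent-sym Adjacentᶠ-irrefl

  ∈N⇒Nb : ∀ {u w} → w ∈ N[_] {G} u → Nb (label u) (label w)
  ∈N⇒Nb w∈N[u] with ∈N[]⁻ {G} w∈N[u]
  ... | inj₁ refl = Nb-self
  ... | inj₂ u~w  = inj₂ (proj₂ (Adj⁻ u~w))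

  Nb⇒∈N : ∀ {u w} → Nb (label u) (label w) → w ∈ N[_] {G} u
  Nb⇒∈N {u} {w} (inj₁ eq) = ∈N[]⁺ {G} (inj₁ (label-injective eq))
  Nb⇒∈N {u} {w} (inj₂ rel) with ≡-dec _≟ᴮ_ (label u) (label w)
  ... | yes eq = ∈N[]⁺ {G} (inj₁ (label-injective (sym eq)))
  ... | no  ne = ∈N[]⁺ {G} (inj₂ (Adj⁺ (ne , rel)))

  vertex-∈N : ∀ {u Z} (Z≢0 : Nonzero Z) → Nb (label u) Z → vertex Z Z≢0 ∈ N[_] {G} u
  vertex-∈N {u} Z≢0 nb = Nb⇒∈N (subst (Nb (label u)) (sym (label∘vertex _ Z≢0)) nb)

  ∈I⇒Nb : ∀ {C u w} → w ∈ I G C u → Nb (label u) (label w)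
  ∈I⇒Nb {C} {u} w∈I = ∈N⇒Nb (proj₁ (x∈p∩q⁻ (N[_] {G} u) C w∈I))

  ∈I⇒∈C : ∀ {C u w} → w ∈ I G C u → w ∈ C
  ∈I⇒∈C {C} {u} w∈I = proj₂ (x∈p∩q⁻ (N[_] {G} u) C w∈I)

  ∈I△I⇒InΔ : ∀ {C u v w} → w ∈ I G C u △ I G C v → InΔ (label u) (label v) (label w)
  ∈I△I⇒InΔ {C} {u} {v} {w} w∈△ with x∈p△q⁻ (I G C u) (I G C v) w∈△
  ... | inj₁ (w∈Iu , w∉Iv) = inˡ (∈I⇒Nb w∈Iu) (λ nb → w∉Iv (x∈p∩q⁺ (Nb⇒∈N nb , ∈I⇒∈C {C} {u} w∈Iu)))
  ... | inj₂ (w∉Iu , w∈Iv) = inʳ (λ nb → w∉Iu (x∈p∩q⁺ (Nb⇒∈N nb , ∈I⇒∈C {C} {v} w∈Iv))) (∈I⇒Nb w∈Iv)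

  3≤∣S∣ : ∀ {P : V → Set} {S : Subset N} → (∀ {Z} → P Z → Nonzero Z) →
          (∀ {Z} (Z≢0 : Nonzero Z) → P Z → vertex Z Z≢0 ∈ S) → Three P → 3 ≤ ∣ S ∣
  3≤∣S∣ nonzero ∈S (three z₁ z₂ z₃ d₁₂ d₁₃ d₂₃ p₁ p₂ p₃) =
    3≤∣p∣ (vertex-injective n₁ n₂ d₁₂) (vertex-injective n₁ n₃ d₁₃) (vertex-injective n₂ n₃ d₂₃)
          (∈S n₁ p₁) (∈S n₂ p₂) (∈S n₃ p₃)
    where
    n₁ = nonzero p₁
    n₂ = nonzero p₂
    n₃ = nonzero p₃

  all-vertices-ECIdCode : IsECIdCode G ⊤
  all-vertices-ECIdCode = large , separated
    where
    large : ∀ u → 3 ≤ ∣ I G ⊤ u ∣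
    large u = 3≤∣S∣ (Nb⇒Nonzero (label-nonzero u)) (λ Z≢0 nb → x∈p∩q⁺ (vertex-∈N Z≢0 nb , ∈⊤))
                    (Nb-three (label u) (label-nonzero u))
    ∈I△I : ∀ {u v Z} (Z≢0 : Nonzero Z) → InΔ (label u) (label v) Z → vertex Z Z≢0 ∈ I G ⊤ u △ I G ⊤ v
    ∈I△I {u} {v} {Z} Z≢0 (inj₁ (nbu , ¬nbv)) = x∈p△q⁺ (I G ⊤ u) (I G ⊤ v)
      (inj₁ (x∈p∩q⁺ (vertex-∈N Z≢0 nbu , ∈⊤) , ¬nbv ∘ subst (Nb (label v)) (label∘vertex Z Z≢0) ∘ ∈I⇒Nb))
    ∈I△I {u} {v} {Z} Z≢0 (inj₂ (¬nbu , nbv)) = x∈p△q⁺ (I G ⊤ u) (I G ⊤ v)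
      (inj₂ (¬nbu ∘ subst (Nb (label u)) (label∘vertex Z Z≢0) ∘ ∈I⇒Nb , x∈p∩q⁺ (vertex-∈N Z≢0 nbv , ∈⊤)))
    separated : ∀ u v → u ≢ v → 3 ≤ ∣ I G ⊤ u △ I G ⊤ v ∣
    separated u v u≢v = 3≤∣S∣ (InΔ⇒Nonzero (label-nonzero u) (label-nonzero v)) ∈I△I
      (separate (label u) (label v) (label-nonzero u) (label-nonzero v) (u≢v ∘ label-injective))

  OneOf₃-vertex : ∀ {x w A B} (A≢0 : Nonzero A) (B≢0 : Nonzero B) →
                  OneOf₃ (label x) A B (label w) → OneOf₃ x (vertex A A≢0) (vertex B B≢0) w
  OneOf₃-vertex _   _   (inj₁ eq)        = inj₁ (label-injective eq)
  OneOf₃-vertex A≢0 _   (inj₂ (inj₁ eq)) = inj₂ (inj₁ (label≡⇒≡vertex A≢0 eq))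
  OneOf₃-vertex _   B≢0 (inj₂ (inj₂ eq)) = inj₂ (inj₂ (label≡⇒≡vertex B≢0 eq))

  Forced⇒∈ : ∀ {C} → IsECIdCode G C → ∀ x → Forced (label x) → x ∈ C
  Forced⇒∈ {C} (large , _) x (by-Nb U A B U≢0 A≢0 B≢0 cover) =
    ∈I⇒∈C {C} {u} (3≤∣p∣⇒forced x (vertex A A≢0) (vertex B B≢0) covered (large u))
    where
    u = vertex U U≢0
    covered : ∀ w → w ∈ I G C u → OneOf₃ x (vertex A A≢0) (vertex B B≢0) w
    covered w w∈I = OneOf₃-vertex A≢0 B≢0
      (cover (label w) (subst (λ Y → Nb Y (label w)) (label∘vertex U U≢0) (∈I⇒Nb w∈I)))
  Forced⇒∈ {C} (_ , separated) x (by-Δ U W A B U≢0 W≢0 A≢0 B≢0 U≢W cover)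
    with x∈p△q⁻ (I G C u) (I G C v)
           (3≤∣p∣⇒forced x (vertex A A≢0) (vertex B B≢0) covered
             (separated u v (vertex-injective U≢0 W≢0 U≢W)))
    where
    u = vertex U U≢0
    v = vertex W W≢0
    covered : ∀ w → w ∈ I G C u △ I G C v → OneOf₃ x (vertex A A≢0) (vertex B B≢0) w
    covered w w∈△ = OneOf₃-vertex A≢0 B≢0 (cover (label w)
      (subst₂ (λ Y Y′ → InΔ Y Y′ (label w)) (label∘vertex U U≢0) (label∘vertex W W≢0) (∈I△I⇒InΔ w∈△)))
  ... | inj₁ (x∈Iu , _) = ∈I⇒∈C x∈Iu
  ... | inj₂ (_ , x∈Iv) = ∈I⇒∈C x∈Iv

  γEID≡N : γEID≡ G N
  γEID≡N = (⊤ , all-vertices-ECIdCode , ∣⊤∣≡n N) , every-vertex-forced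
    where
    every-vertex-forced : ∀ C → IsECIdCode G C → N ≤ ∣ C ∣
    every-vertex-forced C ec = ≤-trans (≤-reflexive (sym (∣⊤∣≡n N)))
      (p⊆q⇒∣p∣≤∣q∣ {p = ⊤} λ {x} _ → Forced⇒∈ ec x (forced (label x) (label-nonzero x)))

  code-vertex : Fin k → Fin N
  code-vertex j = vertex (c j) (c-nonzero j)

  C₀ : Subset N
  C₀ = image code-vertex

  bit⇒∈I : ∀ {u j} → lookup (label u) j ≡ true → code-vertex j ∈ I G C₀ u
  bit⇒∈I {u} {j} uj = x∈p∩q⁺ (vertex-∈N (c-nonzero j) (Nb-bit uj) , ∈image code-vertex j)

  ∈I⇒bit : ∀ {u j} → code-vertex j ∈ I G C₀ u → lookup (label u) j ≡ true
  ∈I⇒bit {u} {j} cj∈I = Nb-c⁻ (Nb-sym (subst (Nb (label u)) (label∘vertex (c j) (c-nonzero j)) (∈I⇒Nb cj∈I)))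

  C₀-trace-injective : ∀ {u v} → I G C₀ u ≡ I G C₀ v → u ≡ v
  C₀-trace-injective {u} {v} eq = label-injective (lookup-ext λ j → ⇔true⇒≡
    (λ uj → ∈I⇒bit (subst (code-vertex j ∈_) eq (bit⇒∈I uj)))
    (λ vj → ∈I⇒bit (subst (code-vertex j ∈_) (sym eq) (bit⇒∈I vj))))

  Adjacent⇒Adj : ∀ {u Y} (Y≢0 : Nonzero Y) → Adjacent (label u) Y → Adj G u (vertex Y Y≢0)
  Adjacent⇒Adj {u} {Y} Y≢0 adj = Adj⁺ (subst (Adjacent (label u)) (sym (label∘vertex Y Y≢0)) adj)

  dominator : ∀ X → Nonzero X → ∃ λ j → Adjacent X (c j)
  dominator X X≢0 with set-bit X≢0
  ... | j , Xj with ≡-dec _≟ᴮ_ X (c j)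
  ...   | no  X≢c  = j , X≢c , inj₂ (code j refl Xj)
  ...   | yes refl with c-neighbour j
  ...     | x , x≢j , cx[j] = x , c≢c (≢-sym x≢j) , inj₁ (code j refl cx[j])

  C₀-TDIdCode : IsTDIdCode G C₀
  C₀-TDIdCode = (λ u v u≢v eq → u≢v (C₀-trace-injective eq)) , dominated
    where
    dominated : ∀ v → ∃ λ u → Adj G v u × u ∈ C₀
    dominated v with dominator (label v) (label-nonzero v)
    ... | j , adj = code-vertex j , Adjacent⇒Adj (c-nonzero j) adj , ∈image code-vertex j

  γtID≡k : γtID≡ G k
  γtID≡k = (C₀ , C₀-TDIdCode , ≤-antisym (∣image∣≤ code-vertex) (k≤∣C∣ C₀ C₀-TDIdCode)) , k≤∣C∣
    where
    k≤∣C∣ : ∀ C → IsTDIdCode G C → k ≤ ∣ C ∣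
    k≤∣C∣ C td = 2^m≤2^n⇒m≤n (≤-trans (≤-reflexive 2^k≡1+N) (IsTDIdCode⇒n<2^∣C∣ {G} td))

  reaches-c₀ : ∀ X → Nonzero X →
    X ≡ c zero ⊎ Adjacent X (c zero) ⊎ ∃ λ j → Adjacent X (c j) × Adjacent (c j) (c zero)
  reaches-c₀ X X≢0 with ≡-dec _≟ᴮ_ X (c zero) | lookup X zero ≟ᴮ true
  ... | yes X≡c₀ | _      = inj₁ X≡c₀
  ... | no  X≢c₀ | yes X₀ = inj₂ (inj₁ (X≢c₀ , inj₂ (code zero refl X₀)))
  ... | no  _    | no  X₀≢true with set-bit X≢0
  ...   | j , Xj = inj₂ (inj₂ (j , (X≢cj , inj₂ (code j refl Xj)) , (c≢c j≢0 , inj₂ (code zero refl (c-zero j)))))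
    where
    X≢cj : X ≢ c j
    X≢cj X≡cj = X₀≢true (trans (cong (λ Z → lookup Z zero) X≡cj) (c-zero j))
    j≢0 : j ≢ zero
    j≢0 refl = X₀≢true Xj

  connected : Connected G
  connected = hub⇒Connected {G} (code-vertex zero) reach
    where
    reach : ∀ u → Star (Adj G) u (code-vertex zero)
    reach u with reaches-c₀ (label u) (label-nonzero u)
    ... | inj₁ u≡c₀ rewrite label≡⇒≡vertex (c-nonzero zero) u≡c₀ = ε
    ... | inj₂ (inj₁ adj) = Adjacent⇒Adj (c-nonzero zero) adj ◅ ε
    ... | inj₂ (inj₂ (j , adj₁ , adj₂)) =
      Adjacent⇒Adj (c-nonzero j) adj₁ ◅
      Adjacent⇒Adj (c-nonzero zero) (subst (λ Y → Adjacent Y (c zero)) (sym (label∘vertex (c j) (c-nonzero j))) adj₂) ◅ ε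

proposition23 : (k : ℕ) → 4 ≤ k →
    Σ Graph (λ G → Connected G × γtID≡ G k × γEID≡ G (2 ^ k ∸ 1))
proposition23 _ (s≤s (s≤s (s≤s (s≤s {n = m} _)))) = G , connected , γtID≡k , γEID≡N
  where open Construction m
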